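{- Let $c\ge1$ and $k_1,\ldots,k_c\ge2$. Let $C_{\mathrm{cop}}(k_1,\ldots,k_c)$ be the least positive integer $n$ such that there is no cover $\{1,\ldots,n\}=A_1\cup\cdots\cup A_c$ (the $A_i$ not necessarily disjoint) with each $A_i$ containing no $k_i$ pairwise coprime integers. Then $C_{\mathrm{cop}}(k_1,\ldots,k_c)=p_{\sum_{i=1}^c(k_i-1)}$, where $p_m$ is the $m$-th prime ($p_1=2$).
   Context: A set of pairwise coprime integers means a set of distinct positive integers any two of which have greatest common divisor $1$. -}

module Defs where

open import Level using (0ℓ)
open import Data.Nat using (ℕ; zero; suc; _+_; _∸_; _≤_; _<_)
open import Data.Nat.Coprimality using (Coprime)
open import Data.Nat.Primality using (Prime; prime?)
open import Data.Fin using (Fin)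
import Data.Fin as Fin
open import Data.List using (List; upTo; filter; length)
open import Data.Product using (Σ; ∃; _×_)
open import Relation.Unary using (Pred)
open import Relation.Nullary using (¬_)
open import Relation.Binary.PropositionalEquality using (_≡_; _≢_)

sumFin : ∀ {c} → (Fin c → ℕ) → ℕ
sumFin {zero}  f = 0
sumFin {suc c} f = f Fin.zero + sumFin (λ i → f (Fin.suc i))

HasPairwiseCoprime : ℕ → Pred ℕ 0ℓ → Set
HasPairwiseCoprime k A =
  Σ (Fin k → ℕ) λ x →
    (∀ i → A (x i)) ×
    (∀ i → 1 ≤ x i) ×
    (∀ i j → i ≢ j → x i ≢ x j) ×
    (∀ i j → i ≢ j → Coprime (x i) (x j))

Cover : ℕ → (c : ℕ) → (Fin c → ℕ) → Set₁
Cover n c k =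
  Σ (Fin c → Pred ℕ 0ℓ) λ A →
    (∀ i x → A i x → 1 ≤ x × x ≤ n) ×
    (∀ x → 1 ≤ x → x ≤ n → ∃ λ i → A i x) ×
    (∀ i → ¬ HasPairwiseCoprime (k i) (A i))

IsCcop : (c : ℕ) → (Fin c → ℕ) → ℕ → Set₁
IsCcop c k N = (1 ≤ N) × ¬ Cover N c k × (∀ n → 1 ≤ n → n < N → Cover n c k)

primeCount : ℕ → ℕ
primeCount n = length (filter prime? (upTo (suc n)))

IsNthPrime : ℕ → ℕ → Set
IsNthPrime m p = Prime p × primeCount p ≡ m

{-# OPTIONS --safe #-}
module Submission where

-- Write s = Σᵢ (kᵢ − 1) and p = p_s. The numbers 1, p_1, …, p_s are s + 1
-- pairwise coprime integers in {1,…,p}, so by the generalised pigeonhole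
-- principle every cover of {1,…,p} puts kᵢ of them into some Aᵢ. Conversely,
-- for n < p label 1 by 0 and every other x ≤ n by the index π(q) < s of one
-- of its prime factors q. Two distinct integers with the same label share a
-- prime factor; cutting the s labels into consecutive blocks of kᵢ − 1 labels and
-- letting Aᵢ collect the integers labelled in block i gives a cover, because
-- among kᵢ elements of Aᵢ two have the same label.

open import Defs
open import Level using (0ℓ)
open import Data.Nat
  using (ℕ; zero; suc; pred; _+_; _∸_; _≤_; _<_; _<?_; _≤′_; ≤′-refl; ≤′-step; z≤n; s≤s; s≤s⁻¹)
open import Data.Nat.Properties
open import Data.Nat.Divisibility using (_∣_; ∣⇒≤; m∣m*n)
open import Data.Nat.Coprimality using (Coprime; 1-coprimeTo; prime⇒coprime)
import Data.Nat.Coprimality as Coprime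
open import Data.Nat.Primality using (Prime; prime?; ¬prime[0]; ¬prime[1]; prime⇒nonZero)
open import Data.Nat.Primality.Factorisation using (factorise)
open import Data.Nat.ListAction using (product)
open import Data.Fin using (Fin; toℕ; fromℕ<) renaming (zero to fzero; suc to fsuc)
import Data.Fin.Properties as Fin
open import Data.Vec.Functional using (updateAt)
open import Data.Vec.Functional.Properties using (updateAt-updates; updateAt-minimal)
open import Data.List using (List; _∷_; [_]; _++_; _∷ʳ_; upTo; filter; length; lookup)
open import Data.List.Properties using (length-++; filter-++; filter-accept; upTo-∷ʳ)
open import Data.List.Relation.Unary.All as All using (All; _∷_)
open import Data.List.Relation.Unary.All.Properties using (all-filter; filter⁺; applyUpTo⁺₁)
open import Data.List.Relation.Unary.Unique.Propositional using (Unique)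
open import Data.List.Relation.Unary.AllPairs using (_∷_)
import Data.List.Relation.Unary.Unique.Propositional.Properties as Unique
open import Data.List.Membership.Propositional.Properties using (∈-lookup)
open import Data.Product using (Σ; ∃-syntax; _×_; _,_; proj₁; proj₂)
open import Data.Sum using (_⊎_; inj₁; inj₂)
open import Data.Empty using (⊥-elim)
open import Function using (_∘_; id)
open import Function.Definitions using (Injective)
open import Relation.Unary using (Pred)
open import Relation.Nullary using (¬_; yes; no)
open import Relation.Binary using (tri<; tri≈; tri>)
open import Relation.Binary.PropositionalEquality
  using (_≡_; _≢_; refl; sym; trans; cong; subst; module ≡-Reasoning)

open ≡-Reasoning

prime⇒≥2 : ∀ {p} → Prime p → 2 ≤ p
prime⇒≥2 {0}           pr = ⊥-elim (¬prime[0] pr)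
prime⇒≥2 {1}           pr = ⊥-elim (¬prime[1] pr)
prime⇒≥2 {suc (suc p)} pr = s≤s (s≤s z≤n)

prime⇒≢1 : ∀ {p} → Prime p → 1 ≢ p
prime⇒≢1 pr refl = ¬prime[1] pr

primeFactor : ∀ {x} → 2 ≤ x → ∃[ q ] Prime q × q ∣ x
primeFactor {x} (s≤s (s≤s _)) with factorise x
... | record { factors = q ∷ qs ; isFactorisation = x≡∏ ; factorsPrime = q-prime ∷ _ } =
  q , q-prime , subst (q ∣_) (sym x≡∏) (m∣m*n (product qs))

UnitOrPrime : Pred ℕ 0ℓ
UnitOrPrime x = x ≡ 1 ⊎ Prime x

unitOrPrime⇒≥1 : ∀ {x} → UnitOrPrime x → 1 ≤ x
unitOrPrime⇒≥1 (inj₁ refl) = s≤s z≤n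
unitOrPrime⇒≥1 (inj₂ pr)   = ≤-trans (s≤s z≤n) (prime⇒≥2 pr)

unitOrPrime-coprime : ∀ {a b} → UnitOrPrime a → UnitOrPrime b → a ≢ b → Coprime a b
unitOrPrime-coprime (inj₁ refl) _ _ = 1-coprimeTo _
unitOrPrime-coprime (inj₂ _) (inj₁ refl) _ = Coprime.sym (1-coprimeTo _)
unitOrPrime-coprime {a} {b} (inj₂ a-prime) (inj₂ b-prime) a≢b with <-cmp a b
... | tri< a<b _ _ = Coprime.sym (prime⇒coprime b-prime {{prime⇒nonZero a-prime}} a<b)
... | tri≈ _ a≡b _ = ⊥-elim (a≢b a≡b)
... | tri> _ _ b<a = prime⇒coprime a-prime {{prime⇒nonZero b-prime}} b<a

primeCount-suc : ∀ n → primeCount (suc n) ≡ primeCount n + length (filter prime? [ suc n ])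
primeCount-suc n = begin
  length (filter prime? (upTo (suc (suc n))))
    ≡⟨ cong (length ∘ filter prime?) (upTo-∷ʳ (suc n)) ⟨
  length (filter prime? (upTo (suc n) ∷ʳ suc n))
    ≡⟨ cong length (filter-++ prime? (upTo (suc n)) [ suc n ]) ⟩
  length (filter prime? (upTo (suc n)) ++ filter prime? [ suc n ])
    ≡⟨ length-++ (filter prime? (upTo (suc n))) ⟩
  primeCount n + length (filter prime? [ suc n ]) ∎

primeCount-≤-suc : ∀ n → primeCount n ≤ primeCount (suc n)
primeCount-≤-suc n = subst (primeCount n ≤_) (sym (primeCount-suc n)) (m≤m+n _ _)

primeCount-suc-prime : ∀ n → Prime (suc n) → primeCount (suc n) ≡ suc (primeCount n)
primeCount-suc-prime n pr = begin
  primeCount (suc n)                              ≡⟨ primeCount-suc n ⟩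
  primeCount n + length (filter prime? [ suc n ])
    ≡⟨ cong (λ xs → primeCount n + length xs) (filter-accept prime? pr) ⟩
  primeCount n + 1                                ≡⟨ +-comm (primeCount n) 1 ⟩
  suc (primeCount n)                              ∎

primeCount-mono-≤′ : ∀ {m n} → m ≤′ n → primeCount m ≤ primeCount n
primeCount-mono-≤′ ≤′-refl           = ≤-refl
primeCount-mono-≤′ (≤′-step {n} m≤n) = ≤-trans (primeCount-mono-≤′ m≤n) (primeCount-≤-suc n)

primeCount-mono-≤ : ∀ {m n} → m ≤ n → primeCount m ≤ primeCount n
primeCount-mono-≤ = primeCount-mono-≤′ ∘ ≤⇒≤′

primeCount-<-prime : ∀ {m q} → Prime q → m < q → primeCount m < primeCount q
primeCount-<-prime {q = suc n} pr (s≤s m≤n) =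
  subst (_ <_) (sym (primeCount-suc-prime n pr)) (s≤s (primeCount-mono-≤ m≤n))

primeCount-prime>0 : ∀ {q} → Prime q → 0 < primeCount q
primeCount-prime>0 pr = primeCount-<-prime pr (≤-trans (s≤s z≤n) (prime⇒≥2 pr))

primeCount-injective : ∀ {q q′} → Prime q → Prime q′ → primeCount q ≡ primeCount q′ → q ≡ q′
primeCount-injective {q} {q′} q-prime q′-prime πq≡πq′ with <-cmp q q′
... | tri< q<q′ _ _ = ⊥-elim (<-irrefl πq≡πq′ (primeCount-<-prime q′-prime q<q′))
... | tri≈ _ q≡q′ _ = q≡q′
... | tri> _ _ q′<q = ⊥-elim (<-irrefl (sym πq≡πq′) (primeCount-<-prime q-prime q′<q))

record DistinctIndices (n : ℕ) {N : ℕ} (P : Pred (Fin N) 0ℓ) : Set where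
  constructor distinctIndices
  field
    index           : Fin n → Fin N
    index-injective : Injective _≡_ _≡_ index
    P-index         : ∀ j → P (index j)

distinctIndices-cast : ∀ {m n N} {P : Pred (Fin N) 0ℓ} → m ≡ n → DistinctIndices m P → DistinctIndices n P
distinctIndices-cast refl d = d

distinctIndices-singleton : ∀ {N} {P : Pred (Fin N) 0ℓ} {i} → P i → DistinctIndices 1 P
distinctIndices-singleton {i = i} Pi = distinctIndices (λ _ → i) (λ { {fzero} {fzero} _ → refl }) (λ _ → Pi)

distinctIndices-cons : ∀ {n N} {P : Pred (Fin (suc N)) 0ℓ} →
  P fzero → DistinctIndices n (P ∘ fsuc) → DistinctIndices (suc n) P
distinctIndices-cons {n} {N} {P} P0 (distinctIndices h h-inj Ph) = distinctIndices h′ h′-inj Ph′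
  where
  h′ : Fin (suc n) → Fin (suc N)
  h′ fzero    = fzero
  h′ (fsuc j) = fsuc (h j)
  h′-inj : ∀ {j j′} → h′ j ≡ h′ j′ → j ≡ j′
  h′-inj {fzero}  {fzero}  _  = refl
  h′-inj {fsuc _} {fsuc _} eq = cong fsuc (h-inj (Fin.suc-injective eq))
  Ph′ : ∀ j → P (h′ j)
  Ph′ fzero    = P0
  Ph′ (fsuc j) = Ph j

distinctIndices-suc : ∀ {n N} {P : Pred (Fin (suc N)) 0ℓ} →
  DistinctIndices n (P ∘ fsuc) → DistinctIndices n P
distinctIndices-suc (distinctIndices h h-inj Ph) = distinctIndices (fsuc ∘ h) (h-inj ∘ Fin.suc-injective) Ph

sumFin-updateAt-pred : ∀ {c} (b : Fin c → ℕ) i {v} → b i ≡ suc v →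
  sumFin b ≡ suc (sumFin (updateAt b i pred))
sumFin-updateAt-pred b fzero    bi≡1+v rewrite bi≡1+v = refl
sumFin-updateAt-pred b (fsuc i) bi≡1+v =
  trans (cong (b fzero +_) (sumFin-updateAt-pred (b ∘ fsuc) i bi≡1+v)) (+-suc (b fzero) _)

ColourClass : ∀ {N c} → (Fin N → Fin c) → Fin c → Pred (Fin N) 0ℓ
ColourClass g i m = g m ≡ i

-- Induction on N: the colour g 0 of the first index either already exceeds
-- its budget, or we lower its budget by one and recurse on the other indices.
sumFin-pigeonhole : ∀ {N c} (g : Fin N → Fin c) (b : Fin c → ℕ) → sumFin b < N →
  ∃[ i ] DistinctIndices (suc (b i)) (ColourClass g i)
sumFin-pigeonhole {suc N} g b Σb<N with b (g fzero) in b[g0]≡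
... | zero = g fzero , distinctIndices-cast (cong suc (sym b[g0]≡)) (distinctIndices-singleton refl)
... | suc v
  with i , d ← sumFin-pigeonhole (g ∘ fsuc) (updateAt b (g fzero) pred)
                 (s≤s⁻¹ (subst (_< suc N) (sumFin-updateAt-pred b (g fzero) b[g0]≡) Σb<N))
  with i Fin.≟ g fzero
... | no i≢g0 =
  i , distinctIndices-suc (distinctIndices-cast (cong suc (updateAt-minimal i (g fzero) b i≢g0)) d)
... | yes refl =
  i , distinctIndices-cast (cong suc (sym b[g0]≡)) (distinctIndices-cons refl
        (distinctIndices-cast (cong suc (trans (updateAt-updates i b) (cong pred b[g0]≡))) d))

PairwiseCoprime : ∀ {N} → (Fin N → ℕ) → Set
PairwiseCoprime x =
  (∀ i → 1 ≤ x i) × (∀ i j → i ≢ j → x i ≢ x j) × (∀ i j → i ≢ j → Coprime (x i) (x j))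

pairwiseCoprime-∘ : ∀ {n N} {x : Fin N → ℕ} {h : Fin n → Fin N} →
  PairwiseCoprime x → Injective _≡_ _≡_ h → PairwiseCoprime (x ∘ h)
pairwiseCoprime-∘ {h = h} (pos , distinct , coprime) h-inj =
  pos ∘ h , (λ i j i≢j → distinct (h i) (h j) (i≢j ∘ h-inj)) ,
            (λ i j i≢j → coprime (h i) (h j) (i≢j ∘ h-inj))

lookup-injective : ∀ {A : Set} {xs : List A} → Unique xs → ∀ {i j} → lookup xs i ≡ lookup xs j → i ≡ j
lookup-injective (_ ∷ _)    {fzero}  {fzero}  _  = refl
lookup-injective (x∉ ∷ _)   {fzero}  {fsuc j} eq = ⊥-elim (All.lookup x∉ (∈-lookup j) eq)
lookup-injective (x∉ ∷ _)   {fsuc i} {fzero}  eq = ⊥-elim (All.lookup x∉ (∈-lookup i) (sym eq))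
lookup-injective (_ ∷ uniq) {fsuc i} {fsuc j} eq = cong fsuc (lookup-injective uniq eq)

lookup-pairwiseCoprime : ∀ {xs} → Unique xs → All UnitOrPrime xs → PairwiseCoprime (lookup xs)
lookup-pairwiseCoprime {xs} uniq units∨primes =
  unitOrPrime⇒≥1 ∘ unitOrPrime ,
  distinct ,
  λ i j i≢j → unitOrPrime-coprime (unitOrPrime i) (unitOrPrime j) (distinct i j i≢j)
  where
  unitOrPrime : ∀ i → UnitOrPrime (lookup xs i)
  unitOrPrime i = All.lookup units∨primes (∈-lookup i)
  distinct : ∀ i j → i ≢ j → lookup xs i ≢ lookup xs j
  distinct i j i≢j = i≢j ∘ lookup-injective uniq

pairwiseCoprime⇒¬Cover : ∀ {n c N} {k : Fin c → ℕ} → (∀ i → 1 ≤ k i) →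
  (x : Fin N → ℕ) → PairwiseCoprime x → (∀ j → x j ≤ n) →
  sumFin (λ i → k i ∸ 1) < N → ¬ Cover n c k
pairwiseCoprime⇒¬Cover {N = N} {k = k} k≥1 x x-coprime x≤n Σ<N (A , _ , covers , noCoprime) =
  colourClassCoprime (sumFin-pigeonhole colour (λ i → k i ∸ 1) Σ<N)
  where
  colour : Fin N → Fin _
  colour j = proj₁ (covers (x j) (proj₁ x-coprime j) (x≤n j))
  colourClassCoprime : ¬ (∃[ i ] DistinctIndices (suc (k i ∸ 1)) (ColourClass colour i))
  colourClassCoprime (i , distinctIndices h h-inj colour∘h≡i) =
    noCoprime i (subst (λ K → HasPairwiseCoprime K (A i)) (m+[n∸m]≡n (k≥1 i))
      (x ∘ h , x∘h∈Ai , pairwiseCoprime-∘ x-coprime h-inj))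
    where
    x∘h∈Ai : ∀ j → A i (x (h j))
    x∘h∈Ai j = subst (λ i′ → A i′ (x (h j))) (colour∘h≡i j)
                     (proj₂ (covers (x (h j)) (proj₁ x-coprime (h j)) (x≤n (h j))))

blockStart : ∀ {c} → (Fin c → ℕ) → Fin c → ℕ
blockStart f fzero    = 0
blockStart f (fsuc i) = f fzero + blockStart (f ∘ fsuc) i

blockOf : ∀ {c} (f : Fin c → ℕ) {t} → t < sumFin f →
  ∃[ i ] Σ (Fin (f i)) λ r → blockStart f i + toℕ r ≡ t
blockOf {suc c} f {t} t<Σf with t <? f fzero
... | yes t<f0 = fzero , fromℕ< t<f0 , Fin.toℕ-fromℕ< t<f0
... | no  t≮f0
  with i , r , eq ← blockOf (f ∘ fsuc)
         (subst (t ∸ f fzero <_) (m+n∸m≡n (f fzero) _) (∸-monoˡ-< t<Σf (≮⇒≥ t≮f0))) =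
  fsuc i , r , (begin
    f fzero + blockStart (f ∘ fsuc) i + toℕ r   ≡⟨ +-assoc (f fzero) _ (toℕ r) ⟩
    f fzero + (blockStart (f ∘ fsuc) i + toℕ r) ≡⟨ cong (f fzero +_) eq ⟩
    f fzero + (t ∸ f fzero)                     ≡⟨ m+[n∸m]≡n (≮⇒≥ t≮f0) ⟩
    t                                           ∎)

labelling⇒Cover : ∀ {n c} {k : Fin c → ℕ} → (∀ i → 1 ≤ k i) → (Label : ℕ → ℕ → Set) →
  (∀ x → 1 ≤ x → x ≤ n → ∃[ t ] t < sumFin (λ i → k i ∸ 1) × Label x t) →
  (∀ {a b t} → Label a t → Label b t → a ≢ b → ¬ Coprime a b) →
  Cover n c k
labelling⇒Cover {n} {c} {k} k≥1 Label label clash = A , (λ _ _ → proj₁) , covers , noCoprime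
  where
  f : Fin c → ℕ
  f i = k i ∸ 1
  A : Fin c → Pred ℕ 0ℓ
  A i x = (1 ≤ x × x ≤ n) × Σ (Fin (f i)) λ r → Label x (blockStart f i + toℕ r)
  covers : ∀ x → 1 ≤ x → x ≤ n → ∃[ i ] A i x
  covers x 1≤x x≤n with t , t<Σ , x↦t ← label x 1≤x x≤n with i , r , eq ← blockOf f t<Σ =
    i , (1≤x , x≤n) , r , subst (Label x) (sym eq) x↦t
  block : ∀ {i x} → A i x → Fin (f i)
  block = proj₁ ∘ proj₂
  labelled : ∀ {i x} (a : A i x) → Label x (blockStart f i + toℕ (block a))
  labelled a = proj₂ (proj₂ a)
  noCoprime : ∀ i → ¬ HasPairwiseCoprime (k i) (A i)
  noCoprime i (x , x∈A , _ , distinct , coprime)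
    with j , j′ , j<j′ , r≡r′ ← Fin.pigeonhole (∸-monoʳ-< (s≤s z≤n) (k≥1 i)) (block ∘ x∈A) =
    clash (labelled (x∈A j))
          (subst (λ r → Label (x j′) (blockStart f i + toℕ r)) (sym r≡r′) (labelled (x∈A j′)))
          (distinct j j′ j≢j′) (coprime j j′ j≢j′)
    where
    j≢j′ : j ≢ j′
    j≢j′ = Fin.<⇒≢ j<j′

PrimeLabel : ℕ → ℕ → Set
PrimeLabel x t = (x ≡ 1 × t ≡ 0) ⊎ ∃[ q ] Prime q × q ∣ x × primeCount q ≡ t

primeLabel-< : ∀ {p x} → Prime p → 1 ≤ x → x < p → ∃[ t ] t < primeCount p × PrimeLabel x t
primeLabel-< {x = 1} p-prime _ _ = 0 , primeCount-prime>0 p-prime , inj₁ (refl , refl)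
primeLabel-< {x = suc (suc _)} p-prime _ x<p
  with q , q-prime , q∣x ← primeFactor (s≤s (s≤s z≤n)) =
  primeCount q , primeCount-<-prime p-prime (≤-<-trans (∣⇒≤ q∣x) x<p) , inj₂ (q , q-prime , q∣x , refl)

primeLabel-clash : ∀ {a b t} → PrimeLabel a t → PrimeLabel b t → a ≢ b → ¬ Coprime a b
primeLabel-clash (inj₁ (a≡1 , _)) (inj₁ (b≡1 , _)) a≢b _ = a≢b (trans a≡1 (sym b≡1))
primeLabel-clash (inj₁ (_ , t≡0)) (inj₂ (q , q-prime , _ , πq≡t)) _ _ =
  <-irrefl (sym (trans πq≡t t≡0)) (primeCount-prime>0 q-prime)
primeLabel-clash (inj₂ (q , q-prime , _ , πq≡t)) (inj₁ (_ , t≡0)) _ _ =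
  <-irrefl (sym (trans πq≡t t≡0)) (primeCount-prime>0 q-prime)
primeLabel-clash (inj₂ (q , q-prime , q∣a , πq≡t)) (inj₂ (q′ , q′-prime , q′∣b , πq′≡t)) _ a⊥b
  with refl ← primeCount-injective q-prime q′-prime (trans πq≡t (sym πq′≡t)) =
  ¬prime[1] (subst Prime (a⊥b (q∣a , q′∣b)) q-prime)

primesUpTo : ℕ → List ℕ
primesUpTo p = filter prime? (upTo (suc p))

unique-1∷primesUpTo : ∀ p → Unique (1 ∷ primesUpTo p)
unique-1∷primesUpTo p =
  All.map prime⇒≢1 (all-filter prime? (upTo (suc p))) ∷ Unique.filter⁺ prime? (Unique.upTo⁺ (suc p))

1∷primesUpTo-unitOrPrime : ∀ p → All UnitOrPrime (1 ∷ primesUpTo p)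
1∷primesUpTo-unitOrPrime p = inj₁ refl ∷ All.map inj₂ (all-filter prime? (upTo (suc p)))

1∷primesUpTo-≤ : ∀ {p} → 1 ≤ p → All (_≤ p) (1 ∷ primesUpTo p)
1∷primesUpTo-≤ {p} 1≤p = 1≤p ∷ All.map s≤s⁻¹ (filter⁺ prime? (applyUpTo⁺₁ id (suc p) id))

corollary3p4 : (c : ℕ) → 1 ≤ c → (k : Fin c → ℕ) → (∀ i → 2 ≤ k i) →
    (p : ℕ) → IsNthPrime (sumFin (λ i → k i ∸ 1)) p → IsCcop c k p
corollary3p4 c _ k k≥2 p (p-prime , πp≡Σ) = 1≤p , noCover , λ n _ n<p → cover n n<p
  where
  k≥1 : ∀ i → 1 ≤ k i
  k≥1 i = ≤-trans (s≤s z≤n) (k≥2 i)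
  1≤p : 1 ≤ p
  1≤p = ≤-trans (s≤s z≤n) (prime⇒≥2 p-prime)
  noCover : ¬ Cover p c k
  noCover = pairwiseCoprime⇒¬Cover k≥1 (lookup (1 ∷ primesUpTo p))
    (lookup-pairwiseCoprime (unique-1∷primesUpTo p) (1∷primesUpTo-unitOrPrime p))
    (λ j → All.lookup (1∷primesUpTo-≤ 1≤p) (∈-lookup j)) (s≤s (≤-reflexive (sym πp≡Σ)))
  cover : ∀ n → n < p → Cover n c k
  cover n n<p = labelling⇒Cover k≥1 PrimeLabel
    (λ x 1≤x x≤n → let t , t<πp , x↦t = primeLabel-< p-prime 1≤x (≤-<-trans x≤n n<p)
                   in t , subst (t <_) πp≡Σ t<πp , x↦t)
    primeLabel-clash
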